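{- If there exists a $(u\times v,g\times h,\{4,5\},1)$-BDP, then there exists a $(2u\times 6v,2g\times 6h,\{4,5\},1)$-BDP.
   Context: Let $G$ be a finite additive group and $K$ a set of positive integers. For $C\subseteq G$, $\Delta C$ denotes the multiset of all differences $x-y$ with $(x,y)$ an ordered pair of distinct elements of $C$. A $(G,K,1)$ difference packing is a set $\mathcal B$ of subsets of $G$ (blocks), each of size in $K$, such that the multiset $\bigcup_{B\in\mathcal B}\Delta B$ contains every element of $G$ at most once; its difference leave is the set of elements of $G$ not occurring in this multiset. It is balanced (BDP) if the number of blocks of size $k$ is the same for every $k\in K$. For $s\mid u$ and $t\mid v$, a $(u\times v,s\times t,K,1)$-BDP is a balanced $(Z_u\times Z_v,K,1)$ difference packing whose difference leave is exactly the subgroup $(u/s)Z_u\times (v/t)Z_v$. -}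

module Defs where

open import Data.Nat using (ℕ; _+_; _*_; _∸_; _≤_; NonZero)
open import Data.Nat.DivMod using (_mod_)
open import Data.Nat.Divisibility using (_∣_; quotient)
open import Data.Fin using (Fin; toℕ)
open import Data.Fin.Properties using () renaming (_≟_ to _≟F_)
open import Data.Product using (_×_; _,_; proj₁; proj₂)
open import Data.Product.Properties using (≡-dec)
open import Data.List using (List; []; _∷_; length; filter; concatMap; allFin; lookup)
open import Data.List.Relation.Unary.Unique.Propositional using (Unique)
open import Relation.Binary.PropositionalEquality using (_≡_; _≢_)
open import Relation.Binary.Definitions using (DecidableEquality)
open import Relation.Nullary using (¬_)
open import Relation.Nullary.Decidable using (¬?)
import Data.List
import Data.Nat
import Data.List.Membership.Propositional

G : ℕ → ℕ → Set
G u v = Fin u × Fin v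

_≟G_ : ∀ {u v} → DecidableEquality (G u v)
_≟G_ = ≡-dec _≟F_ _≟F_

subZ : (u : ℕ) .{{_ : NonZero u}} → Fin u → Fin u → Fin u
subZ u x y = (toℕ x + (u ∸ toℕ y)) mod u

subG : (u v : ℕ) .{{_ : NonZero u}} .{{_ : NonZero v}} → G u v → G u v → G u v
subG u v (x₁ , x₂) (y₁ , y₂) = subZ u x₁ y₁ , subZ v x₂ y₂

-- A block is a finite subset of G, given as a duplicate-free list.
Block : ℕ → ℕ → Set
Block u v = List (G u v)

-- ΔB : the multiset (list) of differences x - y over ordered pairs of
-- distinct elements (distinct positions; the block has no duplicates).
Δ : (u v : ℕ) .{{_ : NonZero u}} .{{_ : NonZero v}} → Block u v → List (G u v)
Δ u v B =
  concatMap (λ i →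
    concatMap (λ j → Data.List.map (λ _ → subG u v (lookup B i) (lookup B j))
                       (filter (λ _ → ¬? (i ≟F j)) (i ∷ [])))
      (allFin (length B)))
    (allFin (length B))

ΔAll : (u v : ℕ) .{{_ : NonZero u}} .{{_ : NonZero v}} → List (Block u v) → List (G u v)
ΔAll u v 𝓑 = concatMap (Δ u v) 𝓑

count : ∀ {u v} → G u v → List (G u v) → ℕ
count g xs = length (filter (λ x → x ≟G g) xs)

numBlocksOfSize : ∀ {u v} → ℕ → List (Block u v) → ℕ
numBlocksOfSize k 𝓑 = length (filter (λ B → length B Data.Nat.≟ k) 𝓑)

InK45 : ℕ → Set
InK45 k = (k ≡ 4) Data.Sum.⊎ (k ≡ 5)
  where import Data.Sum

-- membership in the subgroup (u/s)Z_u × (v/t)Z_v, where u/s, v/t are the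
-- quotients witnessing s ∣ u and t ∣ v
InSubgroup : ∀ {u v s t} → s ∣ u → t ∣ v → G u v → Set
InSubgroup s∣u t∣v (x , y) = (quotient s∣u ∣ toℕ x) × (quotient t∣v ∣ toℕ y)

record BDP45 (u v s t : ℕ) .{{_ : NonZero u}} .{{_ : NonZero v}}
             (s∣u : s ∣ u) (t∣v : t ∣ v) : Set where
  field
    blocks    : List (Block u v)
    distinct  : ∀ B → B Data.List.Membership.Propositional.∈ blocks → Unique B
    sizes     : ∀ B → B Data.List.Membership.Propositional.∈ blocks → InK45 (length B)
    packing   : ∀ g → count g (ΔAll u v blocks) ≤ 1
    leave     : ∀ g → (count g (ΔAll u v blocks) ≡ 0 → InSubgroup s∣u t∣v g)
                    × (InSubgroup s∣u t∣v g → count g (ΔAll u v blocks) ≡ 0)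
    balanced  : numBlocksOfSize 4 blocks ≡ numBlocksOfSize 5 blocks

-- Each block of the given packing has at most five points; number them by rows of a (Z₂ × Z₆, 5, 1)
-- difference matrix M with twelve columns and replace the block by twelve blocks, one per column c, lifting the
-- point (x, y) in row r to (x + M₂(c, r) u , y + M₆(c, r) v) in Z_{2u} × Z_{6v}.  Write an element of
-- Z_{2u} × Z_{6v} by its low digits in Z_u × Z_v and its high digits in Z₂ × Z₆.  The difference of two lifted
-- points has the old difference as low digits, and its high digits are the difference of two rows of M shifted
-- by the carries of the low digits, so as c varies they run over Z₂ × Z₆ exactly once.  Hence every element
-- occurs among the new differences exactly as often as its low digits occur among the old ones: the new
-- packing is a packing, its leave is the preimage of the old leave, namely (2u/2g)Z_{2u} × (6v/6h)Z_{6v}, and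
-- every block size occurs twelve times as often, so balance is kept.

module Submission where

open import Defs
open import Level using (Level)
open import Function using (_∘_; id)
open import Function.Bundles using (_⇔_; mk⇔; Equivalence)
open import Data.Empty using (⊥-elim)
open import Data.Sum using (inj₁; inj₂)
open import Data.Product using (_×_; _,_; proj₁; proj₂)
open import Data.Product.Properties using (,-injective)
open import Data.Product.Function.NonDependent.Propositional using (_×-⇔_)
open import Data.Nat using (ℕ; suc; _+_; _*_; _∸_; _%_; _/_; _<_; _≤_; NonZero; _≟_)
open import Data.Nat.Properties
open import Data.Nat.DivMod
open import Data.Nat.Divisibility using (_∣_; divides; quotient; quotient-∣; *-monoʳ-∣; ∣n⇒∣m*n; ∣m+n∣m⇒∣n; ∣m∣n⇒∣m+n)
open import Data.Nat.ListAction using (sum)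
open import Data.Nat.ListAction.Properties using (sum-++)
open import Data.Nat.Tactic.RingSolver using (solve-∀)
open import Algebra.Properties.CommutativeSemigroup +-commutativeSemigroup
  using () renaming (interchange to +-interchange)
open import Algebra.Properties.CommutativeSemigroup *-commutativeSemigroup
  using () renaming (interchange to *-interchange; x∙yz≈y∙xz to x*[y*z]≡y*[x*z])
open import Data.Fin using (Fin; toℕ; cast; fromℕ<)
open import Data.Fin.Properties using (toℕ-cast; cast-is-id; toℕ-injective; toℕ-fromℕ<; toℕ<n; all?) renaming (_≟_ to _≟F_)
open import Data.Vec using (Vec; []; _∷_)
import Data.Vec as V
open import Data.List using (List; []; _∷_; length; filter; concatMap; allFin; lookup; map; _++_; tabulate)
open import Data.List.Properties
  using (map-++; map-∘; map-cong; map-cong-local; length-tabulate; lookup-tabulate; map-tabulate; tabulate-cong; tabulate-lookup)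
open import Data.List.Relation.Unary.All using (All)
import Data.List.Relation.Unary.All as All
import Data.List.Relation.Unary.All.Properties as All
open import Data.List.Relation.Unary.Unique.Propositional using (Unique)
import Data.List.Relation.Unary.Unique.Propositional.Properties as Unique
open import Relation.Nullary using (Dec; yes; no; ¬_; ¬?)
open import Relation.Nullary.Decidable using (_×-dec_; _→-dec_; toWitness)
open import Relation.Unary using (Decidable)
open import Relation.Binary.PropositionalEquality
open ≡-Reasoning

private
  variable
    a p q : Level
    A B : Set a

∑ : (A → ℕ) → List A → ℕ
∑ f xs = sum (map f xs)

infix 5 ∑
syntax ∑ (λ x → e) xs = ∑[ x ∈ xs ] e

∑-cong : ∀ {f g : A → ℕ} xs → (∀ x → f x ≡ g x) → ∑ f xs ≡ ∑ g xs
∑-cong xs f≗g = cong sum (map-cong f≗g xs)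

∑-++ : ∀ (f : A → ℕ) xs ys → ∑ f (xs ++ ys) ≡ ∑ f xs + ∑ f ys
∑-++ f xs ys = trans (cong sum (map-++ f xs ys)) (sum-++ (map f xs) (map f ys))

∑-map : ∀ (f : B → ℕ) (g : A → B) xs → ∑ f (map g xs) ≡ ∑ (f ∘ g) xs
∑-map f g xs = cong sum (sym (map-∘ xs))

∑-concatMap : ∀ (f : B → ℕ) (g : A → List B) xs → ∑ f (concatMap g xs) ≡ ∑[ x ∈ xs ] ∑ f (g x)
∑-concatMap f g [] = refl
∑-concatMap f g (x ∷ xs) = trans (∑-++ f (g x) (concatMap g xs)) (cong (∑ f (g x) +_) (∑-concatMap f g xs))

∑-+ : ∀ (f g : A → ℕ) xs → ∑[ x ∈ xs ] (f x + g x) ≡ ∑ f xs + ∑ g xs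
∑-+ f g [] = refl
∑-+ f g (x ∷ xs) = trans (cong (f x + g x +_) (∑-+ f g xs)) (+-interchange (f x) (g x) (∑ f xs) (∑ g xs))

∑-*ˡ : ∀ k (f : A → ℕ) xs → ∑[ x ∈ xs ] (k * f x) ≡ k * ∑ f xs
∑-*ˡ k f [] = sym (*-zeroʳ k)
∑-*ˡ k f (x ∷ xs) = trans (cong (k * f x +_) (∑-*ˡ k f xs)) (sym (*-distribˡ-+ k (f x) _))

∑-const : ∀ (xs : List A) k → ∑[ x ∈ xs ] k ≡ length xs * k
∑-const [] k = refl
∑-const (x ∷ xs) k = cong (k +_) (∑-const xs k)

∑-comm : ∀ (f : A → B → ℕ) xs ys → ∑[ x ∈ xs ] ∑[ y ∈ ys ] f x y ≡ ∑[ y ∈ ys ] ∑[ x ∈ xs ] f x y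
∑-comm f [] ys = sym (trans (∑-const ys 0) (*-zeroʳ (length ys)))
∑-comm f (x ∷ xs) ys = trans (cong (∑ (f x) ys +_) (∑-comm f xs ys)) (sym (∑-+ (f x) (λ y → ∑[ x ∈ xs ] f x y) ys))

∑-allFin-cast : ∀ {m n} (e : m ≡ n) (f : Fin n → ℕ) → ∑ f (allFin n) ≡ ∑ (f ∘ cast e) (allFin m)
∑-allFin-cast {m} refl f = ∑-cong (allFin m) (λ i → cong f (sym (cast-is-id refl i)))

𝟙 : {P : Set p} → Dec P → ℕ
𝟙 (yes _) = 1
𝟙 (no _) = 0

𝟙-cong : {P : Set p} {Q : Set q} (P? : Dec P) (Q? : Dec Q) → (P → Q) → (Q → P) → 𝟙 P? ≡ 𝟙 Q?
𝟙-cong (yes _) (yes _) _ _ = refl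
𝟙-cong (yes p) (no ¬q) f _ = ⊥-elim (¬q (f p))
𝟙-cong (no ¬p) (yes q) _ g = ⊥-elim (¬p (g q))
𝟙-cong (no _) (no _) _ _ = refl

𝟙-× : {P : Set p} {Q : Set q} (P? : Dec P) (Q? : Dec Q) → 𝟙 (P? ×-dec Q?) ≡ 𝟙 P? * 𝟙 Q?
𝟙-× (yes _) (yes _) = refl
𝟙-× (yes _) (no _) = refl
𝟙-× (no _) (yes _) = refl
𝟙-× (no _) (no _) = refl

𝟙-¬-*-cong : {P : Set p} (P? : Dec P) {m n : ℕ} → (¬ P → m ≡ n) → 𝟙 (¬? P?) * m ≡ 𝟙 (¬? P?) * n
𝟙-¬-*-cong (yes _) _ = refl
𝟙-¬-*-cong (no ¬p) m≡n = cong (1 *_) (m≡n ¬p)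

length-filter≡∑𝟙 : {P : A → Set p} (P? : Decidable P) (xs : List A) → length (filter P? xs) ≡ ∑[ x ∈ xs ] 𝟙 (P? x)
length-filter≡∑𝟙 P? [] = refl
length-filter≡∑𝟙 P? (x ∷ xs) with P? x
... | yes _ = cong suc (length-filter≡∑𝟙 P? xs)
... | no _ = length-filter≡∑𝟙 P? xs

𝟙-≟G : ∀ {u v} (x y : G u v) → 𝟙 (x ≟G y) ≡ 𝟙 (proj₁ x ≟F proj₁ y) * 𝟙 (proj₂ x ≟F proj₂ y)
𝟙-≟G (x₁ , x₂) (y₁ , y₂) =
  trans (𝟙-cong _ ((x₁ ≟F y₁) ×-dec (x₂ ≟F y₂)) ,-injective (λ { (refl , refl) → refl })) (𝟙-× (x₁ ≟F y₁) (x₂ ≟F y₂))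

𝟙-≢-cast : ∀ {m n} (e : m ≡ n) (i j : Fin m) → 𝟙 (¬? (cast e i ≟F cast e j)) ≡ 𝟙 (¬? (i ≟F j))
𝟙-≢-cast e i j = 𝟙-cong (¬? (cast e i ≟F cast e j)) (¬? (i ≟F j))
  (λ ne eq → ne (cong (cast e) eq))
  (λ ne eq → ne (toℕ-injective (trans (sym (toℕ-cast e i)) (trans (cong toℕ eq) (toℕ-cast e j)))))

count-concatMap : ∀ {u v} (g : G u v) (f : A → List (G u v)) xs →
  count g (concatMap f xs) ≡ ∑[ x ∈ xs ] count g (f x)
count-concatMap g f xs = begin
  count g (concatMap f xs)                  ≡⟨ length-filter≡∑𝟙 (_≟G g) (concatMap f xs) ⟩
  ∑[ y ∈ concatMap f xs ] 𝟙 (y ≟G g)        ≡⟨ ∑-concatMap (λ y → 𝟙 (y ≟G g)) f xs ⟩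
  ∑[ x ∈ xs ] ∑[ y ∈ f x ] 𝟙 (y ≟G g)       ≡⟨ ∑-cong xs (λ x → sym (length-filter≡∑𝟙 (_≟G g) (f x))) ⟩
  ∑[ x ∈ xs ] count g (f x)                 ∎

module _ {u v : ℕ} .{{_ : NonZero u}} .{{_ : NonZero v}} where

  countΔ : ∀ {n} → (Fin n → G u v) → G u v → ℕ
  countΔ {n} f g = ∑[ i ∈ allFin n ] ∑[ j ∈ allFin n ] 𝟙 (¬? (i ≟F j)) * 𝟙 (subG u v (f i) (f j) ≟G g)

  count-Δ : ∀ (g : G u v) B → count g (Δ u v B) ≡ countΔ (lookup B) g
  count-Δ g B =
    trans (count-concatMap g _ (allFin (length B))) (∑-cong (allFin (length B)) λ i →
      trans (count-concatMap g _ (allFin (length B))) (∑-cong (allFin (length B)) λ j →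
        count-singleton-pair i j (subG u v (lookup B i) (lookup B j))))
    where
    count-singleton-pair : ∀ {n} (i j : Fin n) d →
      count g (map (λ _ → d) (filter (λ _ → ¬? (i ≟F j)) (i ∷ []))) ≡ 𝟙 (¬? (i ≟F j)) * 𝟙 (d ≟G g)
    count-singleton-pair i j d with i ≟F j
    ... | yes _ = refl
    ... | no _ with d ≟G g
    ...   | yes _ = refl
    ...   | no _ = refl

  count-Δ-tabulate : ∀ (g : G u v) {n} (f : Fin n → G u v) → count g (Δ u v (tabulate f)) ≡ countΔ f g
  count-Δ-tabulate g {n} f = begin
    count g (Δ u v (tabulate f))
      ≡⟨ count-Δ g (tabulate f) ⟩
    countΔ f′ g
      ≡⟨ ∑-allFin-cast e _ ⟩
    ∑[ i ∈ allFin n ] ∑[ j ∈ allFin m ] 𝟙 (¬? (cast e i ≟F j)) * 𝟙 (subG u v (f′ (cast e i)) (f′ j) ≟G g)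
      ≡⟨ ∑-cong (allFin n) (λ i → ∑-allFin-cast e _) ⟩
    ∑[ i ∈ allFin n ] ∑[ j ∈ allFin n ]
      𝟙 (¬? (cast e i ≟F cast e j)) * 𝟙 (subG u v (f′ (cast e i)) (f′ (cast e j)) ≟G g)
      ≡⟨ ∑-cong (allFin n) (λ i → ∑-cong (allFin n) λ j →
           cong₂ _*_ (𝟙-≢-cast e i j)
                     (cong₂ (λ x y → 𝟙 (subG u v x y ≟G g)) (lookup-tabulate f i) (lookup-tabulate f j))) ⟩
    countΔ f g ∎
    where
    m = length (tabulate f)
    e : n ≡ m
    e = sym (length-tabulate f)
    f′ = lookup (tabulate f)

x+a*u<k*u : ∀ {k u} (a : Fin k) (x : Fin u) → toℕ x + toℕ a * u < k * u
x+a*u<k*u {u = u} a x = ≤-trans (+-monoˡ-≤ (toℕ a * u) (toℕ<n x)) (*-monoˡ-≤ u (toℕ<n a))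

liftZ : ∀ k u → Fin k → Fin u → Fin (k * u)
liftZ k u a x = fromℕ< (x+a*u<k*u a x)

liftZ-mod : ∀ k u .{{_ : NonZero u}} (a : Fin k) (x : Fin u) → toℕ (liftZ k u a x) mod u ≡ x
liftZ-mod k u a x = toℕ-injective (begin
  toℕ (toℕ (liftZ k u a x) mod u) ≡⟨ toℕ-fromℕ< _ ⟩
  toℕ (liftZ k u a x) % u         ≡⟨ cong (_% u) (toℕ-fromℕ< (x+a*u<k*u a x)) ⟩
  (toℕ x + toℕ a * u) % u         ≡⟨ [m+kn]%n≡m%n (toℕ x) (toℕ a) u ⟩
  toℕ x % u                       ≡⟨ m<n⇒m%n≡m (toℕ<n x) ⟩
  toℕ x                           ∎)

-- 1 when toℕ x ≥ toℕ y, and 0 when the subtraction x − y in Z_u borrows.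
carry : ∀ u .{{_ : NonZero u}} → Fin u → Fin u → ℕ
carry u x y = (toℕ x + (u ∸ toℕ y)) / u

carry<2 : ∀ u .{{_ : NonZero u}} (x y : Fin u) → carry u x y < 2
carry<2 u x y = m<n*o⇒m/o<n (≤-trans (+-monoˡ-< (u ∸ toℕ y) (toℕ<n x))
  (≤-trans (+-monoʳ-≤ u (m∸n≤m u (toℕ y))) (≤-reflexive (cong (u +_) (sym (+-identityʳ u))))))

-- a − b − 1 + c in Z_K: the high digit of (x + a u) − (y + b u) in Z_{K u} when the low digits have carry c.
highDigit : ∀ K .{{_ : NonZero K}} → ℕ → ℕ → ℕ → ℕ
highDigit K a b c = (a + (K ∸ b) + c + (K ∸ 1)) % K

%-unique : ∀ n .{{_ : NonZero n}} r m x y → r < n → r + x * n ≡ m + y * n → m % n ≡ r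
%-unique n r m x y r<n eq = begin
  m % n           ≡⟨ [m+kn]%n≡m%n m y n ⟨
  (m + y * n) % n ≡⟨ cong (_% n) eq ⟨
  (r + x * n) % n ≡⟨ [m+kn]%n≡m%n r x n ⟩
  r % n           ≡⟨ m<n⇒m%n≡m r<n ⟩
  r               ∎

%-/-unique : ∀ n .{{_ : NonZero n}} r q m → r < n → r + q * n ≡ m → r ≡ m % n × q ≡ m / n
%-/-unique n r q m r<n eq = r≡m%n , q≡m/n
  where
  r≡m%n : r ≡ m % n
  r≡m%n = sym (%-unique n r m q 0 r<n (trans eq (sym (+-identityʳ m))))
  q≡m/n : q ≡ m / n
  q≡m/n = *-cancelʳ-≡ q (m / n) n (+-cancelˡ-≡ r _ _
    (trans eq (trans (m≡m%n+[m/n]*n m n) (cong (_+ (m / n) * n) (sym r≡m%n)))))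

-- The proof adds w₀ + w₁ u + c u + u to both sides, which turns the borrow identity into one without truncated
-- subtraction.
%-sub-digits : ∀ k u .{{_ : NonZero u}} z₀ z₁ w₀ w₁ → z₀ < u → w₀ < u → z₁ < suc k → w₁ < suc k →
  let instance _ = m*n≢0 (suc k) u in
  (z₀ + z₁ * u + (suc k * u ∸ (w₀ + w₁ * u))) % (suc k * u)
    ≡ (z₀ + (u ∸ w₀)) % u + highDigit (suc k) z₁ w₁ ((z₀ + (u ∸ w₀)) / u) * u
%-sub-digits k u z₀ z₁ w₀ w₁ z₀<u w₀<u z₁<K w₁<K =
  %-unique N R D (S₁ / K) 1 R<N (+-cancelʳ-≡ X _ _ shifted)
  where
  instance _ = m*n≢0 (suc k) u
  K = suc k
  N = K * u
  S₀ = z₀ + (u ∸ w₀)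
  c = S₀ / u
  S₁ = z₁ + (K ∸ w₁) + c + k
  H = S₁ % K
  W = w₀ + w₁ * u
  D = z₀ + z₁ * u + (N ∸ W)
  R = S₀ % u + H * u
  X = W + c * u + u
  R<N : R < N
  R<N = ≤-trans (+-monoˡ-≤ (H * u) (m%n<n S₀ u)) (*-monoˡ-≤ u (m%n<n S₁ K))
  low : S₀ % u + c * u + w₀ ≡ z₀ + u
  low = begin
    S₀ % u + c * u + w₀    ≡⟨ cong (_+ w₀) (m≡m%n+[m/n]*n S₀ u) ⟨
    S₀ + w₀                ≡⟨ +-assoc z₀ (u ∸ w₀) w₀ ⟩
    z₀ + ((u ∸ w₀) + w₀)   ≡⟨ cong (z₀ +_) (m∸n+n≡m (<⇒≤ w₀<u)) ⟩
    z₀ + u                 ∎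
  high : H + S₁ / K * K + w₁ + 1 ≡ z₁ + c + (K + K)
  high = begin
    H + S₁ / K * K + w₁ + 1           ≡⟨ cong (λ t → t + w₁ + 1) (m≡m%n+[m/n]*n S₁ K) ⟨
    z₁ + (K ∸ w₁) + c + k + w₁ + 1    ≡⟨ regroup z₁ (K ∸ w₁) c k w₁ ⟩
    z₁ + c + K + ((K ∸ w₁) + w₁)      ≡⟨ cong (z₁ + c + K +_) (m∸n+n≡m (<⇒≤ w₁<K)) ⟩
    z₁ + c + K + K                    ≡⟨ +-assoc (z₁ + c) K K ⟩
    z₁ + c + (K + K)                  ∎
    where
    regroup : ∀ z₁ d c k w₁ → z₁ + d + c + k + w₁ + 1 ≡ z₁ + c + suc k + (d + w₁)
    regroup = solve-∀
  W≤N : W ≤ N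
  W≤N = ≤-trans (+-monoˡ-≤ (w₁ * u) (<⇒≤ w₀<u)) (*-monoˡ-≤ u w₁<K)
  D+W : D + W ≡ z₀ + z₁ * u + N
  D+W = trans (+-assoc (z₀ + z₁ * u) (N ∸ W) W) (cong (z₀ + z₁ * u +_) (m∸n+n≡m W≤N))
  shifted : R + S₁ / K * N + X ≡ D + 1 * N + X
  shifted = begin
    R + S₁ / K * N + X                                   ≡⟨ ring₁ (S₀ % u) H (S₁ / K) K u w₀ w₁ c ⟩
    (S₀ % u + c * u + w₀) + (H + S₁ / K * K + w₁ + 1) * u ≡⟨ cong₂ (λ p q → p + q * u) low high ⟩
    (z₀ + u) + (z₁ + c + (K + K)) * u                    ≡⟨ ring₂ z₀ z₁ K u c ⟩
    (z₀ + z₁ * u + N) + N + c * u + u                    ≡⟨ cong (λ t → t + N + c * u + u) D+W ⟨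
    (D + W) + N + c * u + u                              ≡⟨ ring₃ D K u w₀ w₁ c ⟨
    D + 1 * N + X                                        ∎
    where
    ring₁ : ∀ L H m K u w₀ w₁ c →
      L + H * u + m * (K * u) + (w₀ + w₁ * u + c * u + u) ≡ (L + c * u + w₀) + (H + m * K + w₁ + 1) * u
    ring₁ = solve-∀
    ring₂ : ∀ z₀ z₁ K u c → (z₀ + u) + (z₁ + c + (K + K)) * u ≡ (z₀ + z₁ * u + K * u) + K * u + c * u + u
    ring₂ = solve-∀
    ring₃ : ∀ D K u w₀ w₁ c → D + 1 * (K * u) + (w₀ + w₁ * u + c * u + u) ≡ (D + (w₀ + w₁ * u)) + K * u + c * u + u
    ring₃ = solve-∀

module _ (k u : ℕ) .{{_ : NonZero u}} where
  private instance
    k*u≢0 : NonZero (suc k * u)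
    k*u≢0 = m*n≢0 (suc k) u

  toℕ-subZ-liftZ : ∀ a b x y →
    toℕ (subZ (suc k * u) (liftZ (suc k) u a x) (liftZ (suc k) u b y))
      ≡ toℕ (subZ u x y) + highDigit (suc k) (toℕ a) (toℕ b) (carry u x y) * u
  toℕ-subZ-liftZ a b x y = begin
    toℕ (subZ (suc k * u) (liftZ (suc k) u a x) (liftZ (suc k) u b y))
      ≡⟨ toℕ-fromℕ< _ ⟩
    (toℕ (liftZ (suc k) u a x) + (suc k * u ∸ toℕ (liftZ (suc k) u b y))) % (suc k * u)
      ≡⟨ cong₂ (λ p q → (p + (suc k * u ∸ q)) % (suc k * u)) (toℕ-fromℕ< (x+a*u<k*u a x)) (toℕ-fromℕ< (x+a*u<k*u b y)) ⟩
    (toℕ x + toℕ a * u + (suc k * u ∸ (toℕ y + toℕ b * u))) % (suc k * u)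
      ≡⟨ %-sub-digits k u (toℕ x) (toℕ a) (toℕ y) (toℕ b) (toℕ<n x) (toℕ<n y) (toℕ<n a) (toℕ<n b) ⟩
    (toℕ x + (u ∸ toℕ y)) % u + highDigit (suc k) (toℕ a) (toℕ b) (carry u x y) * u
      ≡⟨ cong (_+ highDigit (suc k) (toℕ a) (toℕ b) (carry u x y) * u) (toℕ-fromℕ< (m%n<n (toℕ x + (u ∸ toℕ y)) u)) ⟨
    toℕ (subZ u x y) + highDigit (suc k) (toℕ a) (toℕ b) (carry u x y) * u ∎

  𝟙-subZ-liftZ : ∀ a b x y (g : Fin (suc k * u)) →
    𝟙 (subZ (suc k * u) (liftZ (suc k) u a x) (liftZ (suc k) u b y) ≟F g)
      ≡ 𝟙 (subZ u x y ≟F (toℕ g mod u)) * 𝟙 (highDigit (suc k) (toℕ a) (toℕ b) (carry u x y) ≟ toℕ g / u)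
  𝟙-subZ-liftZ a b x y g =
    trans (𝟙-cong (d ≟F g) ((subZ u x y ≟F (toℕ g mod u)) ×-dec (h ≟ toℕ g / u)) digits-of-g g-from-digits)
          (𝟙-× (subZ u x y ≟F (toℕ g mod u)) (h ≟ toℕ g / u))
    where
    d = subZ (suc k * u) (liftZ (suc k) u a x) (liftZ (suc k) u b y)
    h = highDigit (suc k) (toℕ a) (toℕ b) (carry u x y)
    digits-of-g : d ≡ g → (subZ u x y ≡ toℕ g mod u) × (h ≡ toℕ g / u)
    digits-of-g refl with %-/-unique u (toℕ (subZ u x y)) h (toℕ d) (toℕ<n (subZ u x y)) (sym (toℕ-subZ-liftZ a b x y))
    ... | low , high = toℕ-injective (trans low (sym (toℕ-fromℕ< _))) , high
    g-from-digits : (subZ u x y ≡ toℕ g mod u) × (h ≡ toℕ g / u) → d ≡ g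
    g-from-digits (low , high) = toℕ-injective (trans (toℕ-subZ-liftZ a b x y)
      (trans (cong₂ (λ l t → l + t * u) (trans (cong toℕ low) (toℕ-fromℕ< _)) high) (sym (m≡m%n+[m/n]*n (toℕ g) u))))

-- The twelve columns of a (Z₂ × Z₆, 5, 1) difference matrix, split into their Z₂ and Z₆ coordinates.
matrix₂ : Vec (Vec ℕ 5) 12
matrix₂ =
  (0 ∷ 0 ∷ 0 ∷ 0 ∷ 0 ∷ []) ∷ (0 ∷ 0 ∷ 0 ∷ 0 ∷ 0 ∷ []) ∷ (0 ∷ 0 ∷ 0 ∷ 1 ∷ 1 ∷ []) ∷ (0 ∷ 0 ∷ 1 ∷ 1 ∷ 1 ∷ []) ∷
  (0 ∷ 0 ∷ 1 ∷ 0 ∷ 1 ∷ []) ∷ (0 ∷ 0 ∷ 1 ∷ 1 ∷ 0 ∷ []) ∷ (0 ∷ 1 ∷ 1 ∷ 0 ∷ 1 ∷ []) ∷ (0 ∷ 1 ∷ 1 ∷ 1 ∷ 0 ∷ []) ∷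
  (0 ∷ 1 ∷ 1 ∷ 0 ∷ 0 ∷ []) ∷ (0 ∷ 1 ∷ 0 ∷ 1 ∷ 0 ∷ []) ∷ (0 ∷ 1 ∷ 0 ∷ 1 ∷ 1 ∷ []) ∷ (0 ∷ 1 ∷ 0 ∷ 0 ∷ 1 ∷ []) ∷ []

matrix₆ : Vec (Vec ℕ 5) 12
matrix₆ =
  (0 ∷ 0 ∷ 0 ∷ 0 ∷ 0 ∷ []) ∷ (0 ∷ 1 ∷ 2 ∷ 3 ∷ 4 ∷ []) ∷ (0 ∷ 2 ∷ 1 ∷ 2 ∷ 4 ∷ []) ∷ (0 ∷ 3 ∷ 0 ∷ 4 ∷ 3 ∷ []) ∷
  (0 ∷ 4 ∷ 2 ∷ 1 ∷ 1 ∷ []) ∷ (0 ∷ 5 ∷ 1 ∷ 3 ∷ 1 ∷ []) ∷ (0 ∷ 0 ∷ 4 ∷ 2 ∷ 5 ∷ []) ∷ (0 ∷ 1 ∷ 3 ∷ 0 ∷ 5 ∷ []) ∷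
  (0 ∷ 2 ∷ 5 ∷ 5 ∷ 3 ∷ []) ∷ (0 ∷ 3 ∷ 4 ∷ 1 ∷ 2 ∷ []) ∷ (0 ∷ 4 ∷ 3 ∷ 5 ∷ 2 ∷ []) ∷ (0 ∷ 5 ∷ 5 ∷ 4 ∷ 0 ∷ []) ∷ []

entry₂ : Fin 12 → Fin 5 → Fin 2
entry₂ c r = V.lookup (V.lookup matrix₂ c) r mod 2

entry₆ : Fin 12 → Fin 5 → Fin 6
entry₆ c r = V.lookup (V.lookup matrix₆ c) r mod 6

columnsWithHighDigits : Fin 5 → Fin 5 → ℕ → ℕ → ℕ → ℕ → ℕ
columnsWithHighDigits r s c₂ t₂ c₆ t₆ = ∑[ c ∈ allFin 12 ]
    𝟙 (highDigit 2 (toℕ (entry₂ c r)) (toℕ (entry₂ c s)) c₂ ≟ t₂)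
  * 𝟙 (highDigit 6 (toℕ (entry₆ c r)) (toℕ (entry₆ c s)) c₆ ≟ t₆)

-- For a fixed carry the high digit is the difference of the two entries shifted by a constant, so this is the
-- difference-matrix property, decided for both carry values.
columnsWithHighDigits≡1 : ∀ r s → r ≢ s →
  ∀ {c₂} → c₂ < 2 → ∀ {t₂} → t₂ < 2 → ∀ {c₆} → c₆ < 2 → ∀ {t₆} → t₆ < 6 → columnsWithHighDigits r s c₂ t₂ c₆ t₆ ≡ 1
columnsWithHighDigits≡1 = toWitness {a? = all? λ r → all? λ s → ¬? (r ≟F s) →-dec
  allUpTo? (λ c₂ → allUpTo? (λ t₂ → allUpTo? (λ c₆ → allUpTo? (λ t₆ →
    columnsWithHighDigits r s c₂ t₂ c₆ t₆ ≟ 1) 6) 2) 2) 2} _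

row : ∀ {n} → Fin n → Fin 5
row i = toℕ i mod 5

row-injective : ∀ {n} → n ≤ 5 → {i j : Fin n} → row i ≡ row j → i ≡ j
row-injective n≤5 {i} {j} eq = toℕ-injective (begin
  toℕ i             ≡⟨ small i ⟨
  toℕ (row i)       ≡⟨ cong toℕ eq ⟩
  toℕ (row j)       ≡⟨ small j ⟩
  toℕ j             ∎)
  where
  small : ∀ i → toℕ (row i) ≡ toℕ i
  small i = trans (toℕ-fromℕ< _) (m<n⇒m%n≡m (≤-trans (toℕ<n i) n≤5))

module _ (u v : ℕ) .{{_ : NonZero u}} .{{_ : NonZero v}} where
  private instance
    2u≢0 : NonZero (2 * u)
    2u≢0 = m*n≢0 2 u
    6v≢0 : NonZero (6 * v)
    6v≢0 = m*n≢0 6 v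

  liftG : Fin 12 → Fin 5 → G u v → G (2 * u) (6 * v)
  liftG c r (x₁ , x₂) = liftZ 2 u (entry₂ c r) x₁ , liftZ 6 v (entry₆ c r) x₂

  reduce : G (2 * u) (6 * v) → G u v
  reduce (g₁ , g₂) = toℕ g₁ mod u , toℕ g₂ mod v

  reduce-liftG : ∀ c r x → reduce (liftG c r x) ≡ x
  reduce-liftG c r (x₁ , x₂) = cong₂ _,_ (liftZ-mod 2 u (entry₂ c r) x₁) (liftZ-mod 6 v (entry₆ c r) x₂)

  ∑-𝟙-subG-liftG : ∀ r s → r ≢ s → (x y : G u v) (g : G (2 * u) (6 * v)) →
    ∑[ c ∈ allFin 12 ] 𝟙 (subG (2 * u) (6 * v) (liftG c r x) (liftG c s y) ≟G g) ≡ 𝟙 (subG u v x y ≟G reduce g)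
  ∑-𝟙-subG-liftG r s r≢s (x₁ , x₂) (y₁ , y₂) (g₁ , g₂) = begin
    ∑[ c ∈ allFin 12 ] 𝟙 (subG (2 * u) (6 * v) (liftG c r (x₁ , x₂)) (liftG c s (y₁ , y₂)) ≟G (g₁ , g₂))
      ≡⟨ ∑-cong (allFin 12) split ⟩
    ∑[ c ∈ allFin 12 ] (low₂ * low₆ * (high₂ c * high₆ c))
      ≡⟨ ∑-*ˡ (low₂ * low₆) (λ c → high₂ c * high₆ c) (allFin 12) ⟩
    low₂ * low₆ * columnsWithHighDigits r s (carry u x₁ y₁) (toℕ g₁ / u) (carry v x₂ y₂) (toℕ g₂ / v)
      ≡⟨ cong (low₂ * low₆ *_) (columnsWithHighDigits≡1 r s r≢s
           (carry<2 u x₁ y₁) (m<n*o⇒m/o<n (toℕ<n g₁)) (carry<2 v x₂ y₂) (m<n*o⇒m/o<n (toℕ<n g₂))) ⟩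
    low₂ * low₆ * 1
      ≡⟨ *-identityʳ _ ⟩
    low₂ * low₆
      ≡⟨ 𝟙-≟G (subG u v (x₁ , x₂) (y₁ , y₂)) (reduce (g₁ , g₂)) ⟨
    𝟙 (subG u v (x₁ , x₂) (y₁ , y₂) ≟G reduce (g₁ , g₂)) ∎
    where
    low₂ = 𝟙 (subZ u x₁ y₁ ≟F (toℕ g₁ mod u))
    low₆ = 𝟙 (subZ v x₂ y₂ ≟F (toℕ g₂ mod v))
    high₂ high₆ : Fin 12 → ℕ
    high₂ c = 𝟙 (highDigit 2 (toℕ (entry₂ c r)) (toℕ (entry₂ c s)) (carry u x₁ y₁) ≟ toℕ g₁ / u)
    high₆ c = 𝟙 (highDigit 6 (toℕ (entry₆ c r)) (toℕ (entry₆ c s)) (carry v x₂ y₂) ≟ toℕ g₂ / v)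
    split : ∀ c → 𝟙 (subG (2 * u) (6 * v) (liftG c r (x₁ , x₂)) (liftG c s (y₁ , y₂)) ≟G (g₁ , g₂))
                    ≡ low₂ * low₆ * (high₂ c * high₆ c)
    split c = begin
      𝟙 (subG (2 * u) (6 * v) (liftG c r (x₁ , x₂)) (liftG c s (y₁ , y₂)) ≟G (g₁ , g₂))
        ≡⟨ 𝟙-≟G (subG (2 * u) (6 * v) (liftG c r (x₁ , x₂)) (liftG c s (y₁ , y₂))) (g₁ , g₂) ⟩
      _ ≡⟨ cong₂ _*_ (𝟙-subZ-liftZ 1 u (entry₂ c r) (entry₂ c s) x₁ y₁ g₁)
                     (𝟙-subZ-liftZ 5 v (entry₆ c r) (entry₆ c s) x₂ y₂ g₂) ⟩
      low₂ * high₂ c * (low₆ * high₆ c)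
        ≡⟨ *-interchange low₂ (high₂ c) low₆ (high₆ c) ⟩
      low₂ * low₆ * (high₂ c * high₆ c) ∎

  liftB : Fin 12 → Block u v → Block (2 * u) (6 * v)
  liftB c B = tabulate (λ i → liftG c (row i) (lookup B i))

  length-liftB : ∀ c B → length (liftB c B) ≡ length B
  length-liftB c B = length-tabulate _

  map-reduce-liftB : ∀ c B → map reduce (liftB c B) ≡ B
  map-reduce-liftB c B = begin
    map reduce (liftB c B)
      ≡⟨ map-tabulate _ reduce ⟩
    tabulate (λ i → reduce (liftG c (row i) (lookup B i)))
      ≡⟨ tabulate-cong (λ i → reduce-liftG c (row i) (lookup B i)) ⟩
    tabulate (lookup B)
      ≡⟨ tabulate-lookup B ⟩
    B ∎

  Unique-liftB : ∀ c {B} → Unique B → Unique (liftB c B)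
  Unique-liftB c {B} B! = Unique.map⁻ (subst Unique (sym (map-reduce-liftB c B)) B!)

  ∑-count-Δ-liftB : ∀ (g : G (2 * u) (6 * v)) B → length B ≤ 5 →
    ∑[ c ∈ allFin 12 ] count g (Δ (2 * u) (6 * v) (liftB c B)) ≡ count (reduce g) (Δ u v B)
  ∑-count-Δ-liftB g B |B|≤5 = begin
    ∑[ c ∈ allFin 12 ] count g (Δ (2 * u) (6 * v) (liftB c B))
      ≡⟨ ∑-cong (allFin 12) (λ c → count-Δ-tabulate g (λ i → liftG c (row i) (lookup B i))) ⟩
    ∑[ c ∈ allFin 12 ] ∑[ i ∈ is ] ∑[ j ∈ is ] 𝟙 (¬? (i ≟F j)) * lifted c i j
      ≡⟨ ∑-comm (λ c i → ∑[ j ∈ is ] 𝟙 (¬? (i ≟F j)) * lifted c i j) (allFin 12) is ⟩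
    ∑[ i ∈ is ] ∑[ c ∈ allFin 12 ] ∑[ j ∈ is ] 𝟙 (¬? (i ≟F j)) * lifted c i j
      ≡⟨ ∑-cong is (λ i → ∑-comm (λ c j → 𝟙 (¬? (i ≟F j)) * lifted c i j) (allFin 12) is) ⟩
    ∑[ i ∈ is ] ∑[ j ∈ is ] ∑[ c ∈ allFin 12 ] 𝟙 (¬? (i ≟F j)) * lifted c i j
      ≡⟨ ∑-cong is (λ i → ∑-cong is λ j → ∑-*ˡ (𝟙 (¬? (i ≟F j))) (λ c → lifted c i j) (allFin 12)) ⟩
    ∑[ i ∈ is ] ∑[ j ∈ is ] 𝟙 (¬? (i ≟F j)) * (∑[ c ∈ allFin 12 ] lifted c i j)
      ≡⟨ ∑-cong is (λ i → ∑-cong is λ j → 𝟙-¬-*-cong (i ≟F j) λ i≢j →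
           ∑-𝟙-subG-liftG (row i) (row j) (i≢j ∘ row-injective |B|≤5) (lookup B i) (lookup B j) g) ⟩
    countΔ (lookup B) (reduce g)
      ≡⟨ count-Δ (reduce g) B ⟨
    count (reduce g) (Δ u v B) ∎
    where
    is = allFin (length B)
    lifted : Fin 12 → Fin (length B) → Fin (length B) → ℕ
    lifted c i j = 𝟙 (subG (2 * u) (6 * v) (liftG c (row i) (lookup B i)) (liftG c (row j) (lookup B j)) ≟G g)

  liftBlocks : List (Block u v) → List (Block (2 * u) (6 * v))
  liftBlocks = concatMap (λ B → map (λ c → liftB c B) (allFin 12))

  ∑-liftBlocks : ∀ (f : Block (2 * u) (6 * v) → ℕ) 𝓑 →
    ∑ f (liftBlocks 𝓑) ≡ ∑[ B ∈ 𝓑 ] ∑[ c ∈ allFin 12 ] f (liftB c B)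
  ∑-liftBlocks f 𝓑 = trans (∑-concatMap f _ 𝓑) (∑-cong 𝓑 λ B → ∑-map f (λ c → liftB c B) (allFin 12))

  All-liftBlocks : {P : Block u v → Set p} {Q : Block (2 * u) (6 * v) → Set q} →
    (∀ {B} c → P B → Q (liftB c B)) → ∀ {𝓑} → All P 𝓑 → All Q (liftBlocks 𝓑)
  All-liftBlocks P⇒Q ps =
    All.concat⁺ (All.map⁺ (All.map (λ {B} pB →
      All.map⁺ {f = λ c → liftB c B} (All.tabulate⁺ {f = id} λ c → P⇒Q c pB)) ps))

  count-ΔAll-liftBlocks : ∀ (g : G (2 * u) (6 * v)) 𝓑 → All (λ B → length B ≤ 5) 𝓑 →
    count g (ΔAll (2 * u) (6 * v) (liftBlocks 𝓑)) ≡ count (reduce g) (ΔAll u v 𝓑)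
  count-ΔAll-liftBlocks g 𝓑 small = begin
    count g (ΔAll (2 * u) (6 * v) (liftBlocks 𝓑))
      ≡⟨ count-concatMap g (Δ (2 * u) (6 * v)) (liftBlocks 𝓑) ⟩
    ∑[ B′ ∈ liftBlocks 𝓑 ] count g (Δ (2 * u) (6 * v) B′)
      ≡⟨ ∑-liftBlocks (count g ∘ Δ (2 * u) (6 * v)) 𝓑 ⟩
    ∑[ B ∈ 𝓑 ] ∑[ c ∈ allFin 12 ] count g (Δ (2 * u) (6 * v) (liftB c B))
      ≡⟨ cong sum (map-cong-local (All.map (λ {B} → ∑-count-Δ-liftB g B) small)) ⟩
    ∑[ B ∈ 𝓑 ] count (reduce g) (Δ u v B)
      ≡⟨ count-concatMap (reduce g) (Δ u v) 𝓑 ⟨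
    count (reduce g) (ΔAll u v 𝓑) ∎

  numBlocksOfSize-liftBlocks : ∀ k 𝓑 → numBlocksOfSize k (liftBlocks 𝓑) ≡ 12 * numBlocksOfSize k 𝓑
  numBlocksOfSize-liftBlocks k 𝓑 = begin
    numBlocksOfSize k (liftBlocks 𝓑)
      ≡⟨ length-filter≡∑𝟙 (λ B′ → length B′ ≟ k) (liftBlocks 𝓑) ⟩
    ∑[ B′ ∈ liftBlocks 𝓑 ] 𝟙 (length B′ ≟ k)
      ≡⟨ ∑-liftBlocks (λ B′ → 𝟙 (length B′ ≟ k)) 𝓑 ⟩
    ∑[ B ∈ 𝓑 ] ∑[ c ∈ allFin 12 ] 𝟙 (length (liftB c B) ≟ k)
      ≡⟨ ∑-cong 𝓑 (λ B → ∑-cong (allFin 12) λ c → cong (λ n → 𝟙 (n ≟ k)) (length-liftB c B)) ⟩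
    ∑[ B ∈ 𝓑 ] ∑[ c ∈ allFin 12 ] 𝟙 (length B ≟ k)
      ≡⟨ ∑-cong 𝓑 (λ B → ∑-const (allFin 12) (𝟙 (length B ≟ k))) ⟩
    ∑[ B ∈ 𝓑 ] (12 * 𝟙 (length B ≟ k))
      ≡⟨ ∑-*ˡ 12 (λ B → 𝟙 (length B ≟ k)) 𝓑 ⟩
    12 * (∑[ B ∈ 𝓑 ] 𝟙 (length B ≟ k))
      ≡⟨ cong (12 *_) (length-filter≡∑𝟙 (λ B → length B ≟ k) 𝓑) ⟨
    12 * numBlocksOfSize k 𝓑 ∎

quotient-*-monoʳ-∣ : ∀ k .{{_ : NonZero k}} {m n} .{{_ : NonZero n}} (m∣n : m ∣ n) →
  quotient (*-monoʳ-∣ k m∣n) ≡ quotient m∣n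
quotient-*-monoʳ-∣ k {m} (divides q refl) =
  *-cancelʳ-≡ _ q (k * m) (trans (sym (_∣_.equality (*-monoʳ-∣ k (divides q refl)))) (x*[y*z]≡y*[x*z] k q m))
  where
  instance
    m≢0 : NonZero m
    m≢0 = m*n≢0⇒n≢0 q
    k*m≢0 : NonZero (k * m)
    k*m≢0 = m*n≢0 k m

∣⇔∣-mod : ∀ {d} w .{{_ : NonZero w}} t → d ∣ w → d ∣ t ⇔ d ∣ toℕ (t mod w)
∣⇔∣-mod {d} w t d∣w = mk⇔ (λ d∣t → ∣m+n∣m⇒∣n (subst (d ∣_) t≡ d∣t) d∣[t/w]*w)
                         (λ d∣t%w → subst (d ∣_) (sym t≡) (∣m∣n⇒∣m+n d∣[t/w]*w d∣t%w))
  where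
  t≡ : t ≡ t / w * w + toℕ (t mod w)
  t≡ = trans (m≡m%n+[m/n]*n t w) (trans (+-comm (t % w) _) (cong (t / w * w +_) (sym (toℕ-fromℕ< (m%n<n t w)))))
  d∣[t/w]*w : d ∣ t / w * w
  d∣[t/w]*w = ∣n⇒∣m*n (t / w) d∣w

quotient-*-monoʳ-∣-∣⇔ : ∀ k .{{_ : NonZero k}} {m n} .{{_ : NonZero n}} (m∣n : m ∣ n) t →
  quotient (*-monoʳ-∣ k m∣n) ∣ t ⇔ quotient m∣n ∣ toℕ (t mod n)
quotient-*-monoʳ-∣-∣⇔ k m∣n t rewrite quotient-*-monoʳ-∣ k m∣n = ∣⇔∣-mod _ t (quotient-∣ m∣n)

InSubgroup-reduce : ∀ {u v g h} .{{_ : NonZero u}} .{{_ : NonZero v}} (g∣u : g ∣ u) (h∣v : h ∣ v) x →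
  InSubgroup (*-monoʳ-∣ 2 g∣u) (*-monoʳ-∣ 6 h∣v) x ⇔ InSubgroup g∣u h∣v (reduce u v x)
InSubgroup-reduce g∣u h∣v (x₁ , x₂) =
  quotient-*-monoʳ-∣-∣⇔ 2 g∣u (toℕ x₁) ×-⇔ quotient-*-monoʳ-∣-∣⇔ 6 h∣v (toℕ x₂)

InK45⇒≤5 : ∀ {k} → InK45 k → k ≤ 5
InK45⇒≤5 (inj₁ refl) = m≤n+m 4 1
InK45⇒≤5 (inj₂ refl) = ≤-refl

corollary3p7 : (u v g h : ℕ) .{{_ : NonZero u}} .{{_ : NonZero v}}
    → (g∣u : g ∣ u) (h∣v : h ∣ v)
    → BDP45 u v g h g∣u h∣v
    → BDP45 (2 * u) (6 * v) (2 * g) (6 * h) {{m*n≢0 2 u}} {{m*n≢0 6 v}}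
        (*-monoʳ-∣ 2 g∣u) (*-monoʳ-∣ 6 h∣v)
corollary3p7 u v g h g∣u h∣v bdp = record
  { blocks   = liftBlocks u v blocks
  ; distinct = λ _ → All.lookup (All-liftBlocks u v (λ c → Unique-liftB u v c) (All.tabulate (distinct _)))
  ; sizes    = λ _ → All.lookup (All-liftBlocks u v (λ {B} c → subst InK45 (sym (length-liftB u v c B)))
                                                   (All.tabulate (sizes _)))
  ; packing  = λ x → subst (_≤ 1) (sym (same-count x)) (packing (reduce u v x))
  ; leave    = λ x →
      (λ unused → Equivalence.from (InSubgroup-reduce g∣u h∣v x)
                    (proj₁ (leave (reduce u v x)) (trans (sym (same-count x)) unused)))
    , (λ inH → trans (same-count x)
                 (proj₂ (leave (reduce u v x)) (Equivalence.to (InSubgroup-reduce g∣u h∣v x) inH)))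
  ; balanced = begin
      numBlocksOfSize 4 (liftBlocks u v blocks) ≡⟨ numBlocksOfSize-liftBlocks u v 4 blocks ⟩
      12 * numBlocksOfSize 4 blocks             ≡⟨ cong (12 *_) balanced ⟩
      12 * numBlocksOfSize 5 blocks             ≡⟨ numBlocksOfSize-liftBlocks u v 5 blocks ⟨
      numBlocksOfSize 5 (liftBlocks u v blocks) ∎
  }
  where
  open BDP45 bdp
  same-count : ∀ x → count x (ΔAll (2 * u) (6 * v) {{m*n≢0 2 u}} {{m*n≢0 6 v}} (liftBlocks u v blocks))
                     ≡ count (reduce u v x) (ΔAll u v blocks)
  same-count x = count-ΔAll-liftBlocks u v x blocks (All.tabulate (InK45⇒≤5 ∘ sizes _))
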